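{- For every squarefree integer $n>6$, $n$ is strictly $2$-dense if and only if $n/P(n)$ is strictly $2$-dense and $P(n)<\sqrt{n}$.
   Context: $P(n)$ denotes the largest prime factor of $n$. For a positive integer $n$ let $1=d_1<d_2<\cdots<d_{\tau(n)}=n$ be its positive divisors in increasing order, where $\tau(n)$ is the number of divisors. A squarefree integer $n$ is strictly $2$-dense if $d_{i+1}/d_i<2$ for all $i$ with $1<i<\tau(n)-1$, and $d_2/d_1=2=d_{\tau(n)}/d_{\tau(n)-1}$ (in particular $n$ is even). -}

module Defs where

open import Data.Nat using (ℕ; zero; suc; _+_; _*_; _∸_; _≤_; _<_)
open import Data.Nat.Divisibility using (_∣_; _∣?_)
open import Data.Nat.Primality using (Prime)
open import Data.List using (List; []; _∷_; length; filter; map; upTo)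
open import Data.Product using (_×_)
open import Relation.Binary.PropositionalEquality using (_≡_)

Squarefree : ℕ → Set
Squarefree n = ∀ k → k * k ∣ n → k ≡ 1

IsLargestPrimeFactor : ℕ → ℕ → Set
IsLargestPrimeFactor p n = Prime p × p ∣ n × (∀ q → Prime q → q ∣ n → q ≤ p)

divisors : ℕ → List ℕ
divisors n = filter (_∣? n) (map suc (upTo n))

-- 0-based list access (default 0; only used at in-range indices below)
nth : List ℕ → ℕ → ℕ
nth []       _       = 0
nth (x ∷ xs) zero    = x
nth (x ∷ xs) (suc k) = nth xs k

-- d i = d_i with the paper's 1-based indexing
d : ℕ → ℕ → ℕ
d n i = nth (divisors n) (i ∸ 1)

τ : ℕ → ℕ
τ n = length (divisors n)

-- strictly 2-dense (for a squarefree n): ratios d_{i+1}/d_i < 2 for 1 < i < τ(n) - 1,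
-- and d₂/d₁ = 2 = d_τ/d_{τ-1}  (ratios written multiplicatively)
record Strictly2Dense (n : ℕ) : Set where
  field
    squarefree : Squarefree n
    twoDivisors : 2 ≤ τ n
    dense : ∀ i → 1 < i → i < τ n ∸ 1 → d n (suc i) < 2 * d n i
    first : d n 2 ≡ 2 * d n 1
    last  : d n (τ n) ≡ 2 * d n (τ n ∸ 1)

module Submission where

-- 1. Strict 2-density, defined through positions in the sorted divisor list, is recast
--    as a statement about divisors alone (Dense): n is squarefree and even, and every
--    divisor x ≥ 2 with 2x < n has a divisor of n strictly between x and 2x.
-- 2. Backward direction (dense-multiple): if m is dense, p ∤ m a prime with p < m, then
--    m p is dense; the new divisors p e are placed by a covering lemma that walks up the
--    divisors of m in steps of at most a factor 2.
-- 3. Forward direction: a dense n has no "gap factorisation" n = A B (A even, A ≥ 4, all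
--    prime factors of B above A).  Gaplessness survives removing the largest prime factor
--    and forces P(n) < n / P(n); by strong induction on m, peeling off P(m) and using 2.,
--    every squarefree gapless multiple of 6 is dense.  A dense n > 6 is such a number.

open import Defs
open import Data.Nat
open import Data.Nat.Properties
open import Data.Nat.Divisibility
open import Data.Nat.Primality
open import Data.Nat.Primality.Factorisation using (factorise)
open import Data.Nat.Coprimality using (Coprime; coprime-divisor)
open import Data.Nat.Induction using (<-rec)
open import Data.List using (List; []; _∷_; length; map; upTo)
open import Data.Nat.ListAction using (product)
open import Data.List.Relation.Unary.Any using (here; there)
open import Data.List.Relation.Unary.All as All using (_∷_)
open import Data.List.Relation.Unary.AllPairs using (AllPairs; _∷_)
import Data.List.Relation.Unary.AllPairs.Properties as AllPairs
open import Data.List.Membership.Propositional using (_∈_)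
open import Data.List.Membership.Propositional.Properties using (∈-filter⁻; ∈-filter⁺; ∈-map⁻; ∈-map⁺; ∈-upTo⁺)
open import Data.Product using (∃-syntax; _×_; _,_; proj₁; proj₂)
open import Data.Sum using (_⊎_; inj₁; inj₂)
open import Relation.Binary.Definitions using (tri<; tri≈; tri>)
open import Data.Empty using (⊥; ⊥-elim)
open import Relation.Nullary using (¬_; yes; no)
open import Relation.Nullary.Decidable using (from-yes)
open import Relation.Binary.PropositionalEquality
open import Function using (id)
open import Function.Bundles using (_⇔_; mk⇔; Equivalence)
open Equivalence using (to; from)

nth-∈ : ∀ (xs : List ℕ) i → i < length xs → nth xs i ∈ xs
nth-∈ (x ∷ xs) zero    _         = here refl
nth-∈ (x ∷ xs) (suc i) (s≤s i<) = there (nth-∈ xs i i<)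

∈⇒nth : ∀ {x} (xs : List ℕ) → x ∈ xs → ∃[ i ] (i < length xs × nth xs i ≡ x)
∈⇒nth (y ∷ xs) (here refl) = 0 , s≤s z≤n , refl
∈⇒nth (y ∷ xs) (there x∈) with ∈⇒nth xs x∈
... | i , i< , eq = suc i , s≤s i< , eq

nth-strictMono : ∀ (xs : List ℕ) → AllPairs _<_ xs → ∀ {i j} → i < j → j < length xs →
  nth xs i < nth xs j
nth-strictMono (x ∷ xs) (x< ∷ _) {zero}  {suc j} _ (s≤s j<) = All.lookup x< (nth-∈ xs j j<)
nth-strictMono (x ∷ xs) (_ ∷ sorted) {suc i} {suc j} (s≤s i<j) (s≤s j<) =
  nth-strictMono xs sorted i<j j<

divisors-sorted : ∀ n → AllPairs _<_ (divisors n)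
divisors-sorted n =
  AllPairs.filter⁺ (_∣? n) (AllPairs.map⁺ (AllPairs.applyUpTo⁺₁ id n (λ i<j _ → s≤s i<j)))

∈-divisors⁻ : ∀ {n x} → x ∈ divisors n → x ∣ n × 0 < x
∈-divisors⁻ {n} x∈ with ∈-filter⁻ (_∣? n) {xs = map suc (upTo n)} x∈
... | x∈map , x∣n with ∈-map⁻ suc x∈map
... | _ , _ , refl = x∣n , s≤s z≤n

∈-divisors⁺ : ∀ {n x} → .{{NonZero n}} → x ∣ n → 0 < x → x ∈ divisors n
∈-divisors⁺ {suc n} {suc x} x∣n _ = ∈-filter⁺ (_∣? suc n) (∈-map⁺ suc (∈-upTo⁺ (∣⇒≤ x∣n))) x∣n

proper-divisor-≤-half : ∀ {x n} → x ∣ n → x < n → 2 * x ≤ n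
proper-divisor-≤-half {x} x∣n x<n =
  subst (2 * x ≤_) (sym (m∣n⇒n≡quotient*m x∣n)) (*-monoˡ-≤ x (quotient>1 x∣n x<n))

DivisorBetween : ℕ → ℕ → Set
DivisorBetween n x = ∃[ e ] (e ∣ n × x < e × e < 2 * x)

record Dense (n : ℕ) : Set where
  field
    squarefree : Squarefree n
    even : 2 ∣ n
    between : ∀ x → x ∣ n → 2 ≤ x → 2 * x < n → DivisorBetween n x

-- Order facts about δ i, the (i+1)-st smallest divisor of a fixed n > 0.
module DivisorList (n : ℕ) .{{_ : NonZero n}} where

  δ : ℕ → ℕ
  δ = nth (divisors n)

  δ-< : ∀ {i j} → i < j → j < τ n → δ i < δ j
  δ-< = nth-strictMono (divisors n) (divisors-sorted n)

  δ-≤ : ∀ {i j} → i ≤ j → j < τ n → δ i ≤ δ j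
  δ-≤ i≤j j< with m≤n⇒m<n∨m≡n i≤j
  ... | inj₁ i<j  = <⇒≤ (δ-< i<j j<)
  ... | inj₂ refl = ≤-refl

  δ-reflects-< : ∀ {i j} → i < τ n → δ i < δ j → i < j
  δ-reflects-< {i} {j} i< δi<δj with i <? j
  ... | yes i<j = i<j
  ... | no  i≮j = ⊥-elim (<⇒≱ δi<δj (δ-≤ (≮⇒≥ i≮j) i<))

  δ-divisor : ∀ {i} → i < τ n → δ i ∣ n × 0 < δ i
  δ-divisor {i} i< = ∈-divisors⁻ (nth-∈ (divisors n) i i<)

  δ-index : ∀ {x} → x ∣ n → 0 < x → ∃[ i ] (i < τ n × δ i ≡ x)
  δ-index x∣n 0<x = ∈⇒nth (divisors n) (∈-divisors⁺ x∣n 0<x)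

  δ-first : 0 < τ n × δ 0 ≡ 1
  δ-first with δ-index (1∣ n) (s≤s z≤n)
  ... | i , i< , δi≡1 = 0<τ , ≤-antisym (subst (δ 0 ≤_) δi≡1 (δ-≤ z≤n i<)) (proj₂ (δ-divisor 0<τ))
    where
      0<τ : 0 < τ n
      0<τ = ≤-<-trans z≤n i<

  δ-last : ∀ {k} → τ n ≡ suc k → δ k ≡ n
  δ-last {k} τ≡ with δ-index ∣-refl (>-nonZero⁻¹ n)
  ... | i , i< , δi≡n = ≤-antisym (∣⇒≤ (proj₁ (δ-divisor k<)))
                                  (subst (_≤ δ k) δi≡n (δ-≤ (≤-pred (subst (i <_) τ≡ i<)) k<))
    where
      k< : k < τ n
      k< = subst (k <_) (sym τ≡) ≤-refl

  δ-index-pos : ∀ {i} → i < τ n → 1 < δ i → 0 < i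
  δ-index-pos {zero}  _ 1<δ0 = ⊥-elim (<-irrefl (sym (proj₂ δ-first)) 1<δ0)
  δ-index-pos {suc i} _ _    = s≤s z≤n

  next-least : ∀ {i e} → suc i < τ n → e ∣ n → δ i < e → δ (suc i) ≤ e
  next-least {i} {e} si< e∣n δi<e with δ-index e∣n (≤-<-trans z≤n δi<e)
  ... | j , j< , δj≡e =
    subst (δ (suc i) ≤_) δj≡e
      (δ-≤ (δ-reflects-< (<-trans (n<1+n i) si<) (subst (δ i <_) (sym δj≡e) δi<e)) j<)

  prev-greatest : ∀ {k e} → suc k < τ n → e ∣ n → 0 < e → e < δ (suc k) → e ≤ δ k
  prev-greatest {k} {e} sk< e∣n 0<e e<δsk with δ-index e∣n 0<e
  ... | j , j< , δj≡e =
    subst (_≤ δ k) δj≡e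
      (δ-≤ (≤-pred (δ-reflects-< j< (subst (_< δ (suc k)) (sym δj≡e) e<δsk))) (<-trans (n<1+n k) sk<))

  -- strict 2-density speaks of the last two divisors, so we name τ n = k + 2
  τ-split : 2 ≤ τ n → ∃[ k ] (τ n ≡ suc (suc k))
  τ-split 2≤τ with τ n | 2≤τ
  ... | suc (suc k) | _         = k , refl
  ... | suc zero    | s≤s ()

  even⇒2≤τ : 2 ∣ n → 2 ≤ τ n
  even⇒2≤τ 2∣n with δ-index ∣-refl (>-nonZero⁻¹ n)
  ... | j , j< , δj≡n = ≤-trans (s≤s (δ-index-pos j< (subst (1 <_) (sym δj≡n) (∣⇒≤ 2∣n)))) j<

  even⇒first : 2 ≤ τ n → 2 ∣ n → δ 1 ≡ 2 * δ 0
  even⇒first 2≤τ 2∣n = trans δ1≡2 (cong (2 *_) (sym δ0≡1))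
    where
      δ0≡1 : δ 0 ≡ 1
      δ0≡1 = proj₂ δ-first
      δ1≡2 : δ 1 ≡ 2
      δ1≡2 = ≤-antisym (next-least 2≤τ 2∣n (subst (_< 2) (sym δ0≡1) ≤-refl))
                       (subst (_< δ 1) δ0≡1 (δ-< (s≤s z≤n) 2≤τ))

  module Top {k : ℕ} (τ≡ : τ n ≡ suc (suc k)) where

    sk<τ : suc k < τ n
    sk<τ = subst (suc k <_) (sym τ≡) ≤-refl

    k<τ : k < τ n
    k<τ = <-trans (n<1+n k) sk<τ

    last⇒half : δ (τ n ∸ 1) ≡ 2 * δ (τ n ∸ 1 ∸ 1) → n ≡ 2 * δ k
    last⇒half last = trans (sym (δ-last τ≡)) (subst (λ t → δ (t ∸ 1) ≡ 2 * δ (t ∸ 1 ∸ 1)) τ≡ last)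

    half⇒last : n ≡ 2 * δ k → δ (τ n ∸ 1) ≡ 2 * δ (τ n ∸ 1 ∸ 1)
    half⇒last n≡ = subst (λ t → δ (t ∸ 1) ≡ 2 * δ (t ∸ 1 ∸ 1)) (sym τ≡) (trans (δ-last τ≡) n≡)

    even⇒half : 2 ∣ n → n ≡ 2 * δ k
    even⇒half 2∣n = ≤-antisym n≤2δk (proper-divisor-≤-half (proj₁ (δ-divisor k<τ)) δk<n)
      where
        h : ℕ
        h = quotient 2∣n
        h≤δk : h ≤ δ k
        h≤δk = prev-greatest sk<τ (quotient-∣ 2∣n) (>-nonZero⁻¹ h {{quotient≢0 2∣n}})
                 (subst (h <_) (sym (δ-last τ≡)) (quotient-< 2∣n))
        n≤2δk : n ≤ 2 * δ k
        n≤2δk = subst (_≤ 2 * δ k) (sym (m∣n⇒n≡m*quotient 2∣n)) (*-monoʳ-≤ 2 h≤δk)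
        δk<n : δ k < n
        δk<n = subst (δ k <_) (δ-last τ≡) (δ-< ≤-refl sk<τ)

    interior : ∀ {i} → suc i < τ n ∸ 1 → i < k
    interior {i} lt = ≤-pred (subst (λ t → suc i < t ∸ 1) τ≡ lt)

    interior⁻ : ∀ {i} → i < k → suc i < τ n ∸ 1
    interior⁻ {i} i<k = subst (λ t → suc i < t ∸ 1) (sym τ≡) (s≤s i<k)

  strictly2Dense⇒dense : Strictly2Dense n → Dense n
  strictly2Dense⇒dense S with τ-split (Strictly2Dense.twoDivisors S)
  ... | k , τ≡ = record { squarefree = squarefree ; even = even ; between = between }
    where
      open Strictly2Dense S
      open Top τ≡
      even : 2 ∣ n
      even = subst (_∣ n) (trans first (cong (2 *_) (proj₂ δ-first)))
                   (proj₁ (δ-divisor (≤-<-trans (s≤s z≤n) sk<τ)))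
      -- a divisor x = δ i with 2 ≤ x and 2x < n = 2 δ k is interior, and δ (i + 1) works
      between : ∀ x → x ∣ n → 2 ≤ x → 2 * x < n → DivisorBetween n x
      between x x∣n 2≤x 2x<n with δ-index x∣n (≤-trans (s≤s z≤n) 2≤x)
      ... | i , i< , refl = δ (suc i) , proj₁ (δ-divisor si<τ) , δ-< ≤-refl si<τ ,
                            dense (suc i) (s≤s (δ-index-pos i< 2≤x)) (interior⁻ i<k)
        where
          i<k : i < k
          i<k = δ-reflects-< i< (*-cancelˡ-< 2 (δ i) (δ k) (subst (2 * δ i <_) (last⇒half last) 2x<n))
          si<τ : suc i < τ n
          si<τ = ≤-<-trans i<k k<τ

  dense⇒strictly2Dense : Dense n → Strictly2Dense n
  dense⇒strictly2Dense D with τ-split (even⇒2≤τ (Dense.even D))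
  ... | k , τ≡ = record
    { squarefree = squarefree ; twoDivisors = even⇒2≤τ even ; dense = dense
    ; first = even⇒first (even⇒2≤τ even) even ; last = half⇒last n≡2δk }
    where
      open Dense D
      open Top τ≡
      n≡2δk : n ≡ 2 * δ k
      n≡2δk = even⇒half even
      -- an interior divisor x = δ i satisfies 2 ≤ x and 2x < n, and δ (i + 1) is at most
      -- the divisor that the density provides between x and 2x
      dense : ∀ i → 1 < i → i < τ n ∸ 1 → δ i < 2 * δ (i ∸ 1)
      dense (suc i) (s≤s 0<i) lt with between (δ i) (proj₁ (δ-divisor i<τ)) 2≤δi 2δi<n
        where
          i<k : i < k
          i<k = interior lt
          i<τ : i < τ n
          i<τ = <-trans i<k k<τ
          2≤δi : 2 ≤ δ i
          2≤δi = subst (_< δ i) (proj₂ δ-first) (δ-< 0<i i<τ)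
          2δi<n : 2 * δ i < n
          2δi<n = subst (2 * δ i <_) (sym n≡2δk) (*-monoʳ-< 2 (δ-< i<k k<τ))
      ... | e , e∣n , δi<e , e<2δi =
        ≤-<-trans (next-least (≤-<-trans (interior lt) k<τ) e∣n δi<e) e<2δi

strictly2Dense⇔dense : ∀ {n} → .{{NonZero n}} → Strictly2Dense n ⇔ Dense n
strictly2Dense⇔dense {n} = mk⇔ strictly2Dense⇒dense dense⇒strictly2Dense
  where open DivisorList n

prime≥2 : ∀ {p} → Prime p → 2 ≤ p
prime≥2 {p} p-prime = nonTrivial⇒n>1 p {{prime⇒nonTrivial p-prime}}

prime-factor : ∀ {n} → 1 < n → ∃[ r ] (Prime r × r ∣ n)
prime-factor {n} 1<n with factorise n {{nonTrivial⇒nonZero n {{n>1⇒nonTrivial 1<n}}}}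
... | record { factors = [] ; isFactorisation = n≡1 } = ⊥-elim (<-irrefl (sym n≡1) 1<n)
... | record { factors = r ∷ rs ; isFactorisation = n≡ ; factorsPrime = r-prime ∷ _ } =
  r , r-prime , divides (product rs) (trans n≡ (*-comm r (product rs)))

-- P(n) exists for n > 1: search downwards from n for a prime divisor.
largest-prime-factor : ∀ {n} → 1 < n → ∃[ q ] IsLargestPrimeFactor q n
largest-prime-factor {n} 1<n = search n (λ r _ r∣n → ∣⇒≤ {{n≢0}} r∣n) (prime-factor 1<n)
  where
    n≢0 : NonZero n
    n≢0 = nonTrivial⇒nonZero n {{n>1⇒nonTrivial 1<n}}
    search : ∀ k → (∀ r → Prime r → r ∣ n → r ≤ k) → ∃[ r ] (Prime r × r ∣ n) →
             ∃[ q ] IsLargestPrimeFactor q n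
    search zero    bound (r , r-prime , r∣n) =
      ⊥-elim (<⇒≱ (prime≥2 r-prime) (≤-trans (bound r r-prime r∣n) z≤n))
    search (suc k) bound some with prime? (suc k) | suc k ∣? n
    ... | yes k-prime | yes k∣n = suc k , k-prime , k∣n , bound
    ... | no ¬k-prime | _       =
      search k (λ r r-prime r∣n → ≤-pred (≤∧≢⇒< (bound r r-prime r∣n) λ { refl → ¬k-prime r-prime })) some
    ... | yes _       | no k∤n  =
      search k (λ r r-prime r∣n → ≤-pred (≤∧≢⇒< (bound r r-prime r∣n) λ { refl → k∤n r∣n })) some

prime-∣-cofactor : ∀ {r q m} → Prime r → Prime q → r ≢ q → r ∣ m * q → r ∣ m
prime-∣-cofactor {r} {q} {m} r-prime q-prime r≢q r∣mq with euclidsLemma m q r-prime r∣mq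
... | inj₁ r∣m = r∣m
... | inj₂ r∣q with prime⇒irreducible q-prime r∣q
...   | inj₁ refl = ⊥-elim (¬prime[1] r-prime)
...   | inj₂ r≡q  = ⊥-elim (r≢q r≡q)

divisor-of-multiple : ∀ {x m p} → Prime p → x ∣ m * p → x ∣ m ⊎ ∃[ y ] (x ≡ p * y × y ∣ m)
divisor-of-multiple {x} {m} {p} p-prime x∣mp with p ∣? x
... | yes (divides y x≡yp) = inj₂ (y , trans x≡yp (*-comm y p) ,
        *-cancelʳ-∣ p {{prime⇒nonZero p-prime}} (subst (_∣ m * p) x≡yp x∣mp))
... | no p∤x = inj₁ (coprime-divisor x⊥p (subst (x ∣_) (*-comm m p) x∣mp))
  where
    x⊥p : Coprime x p
    x⊥p (c∣x , c∣p) with prime⇒irreducible p-prime c∣p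
    ... | inj₁ c≡1 = c≡1
    ... | inj₂ refl = ⊥-elim (p∤x c∣x)

coprime-to-large-primes : ∀ {e b} → 0 < e → (∀ r → Prime r → r ∣ b → e < r) → Coprime e b
coprime-to-large-primes {e} 0<e large {zero} (0∣e , _) = ⊥-elim (<-irrefl (sym (0∣⇒≡0 0∣e)) 0<e)
coprime-to-large-primes {e} 0<e large {suc zero} _ = refl
coprime-to-large-primes {e} 0<e large {suc (suc c)} (c∣e , c∣b)
  with prime-factor {suc (suc c)} (s≤s (s≤s z≤n))
... | r , r-prime , r∣c =
  ⊥-elim (<⇒≱ (large r r-prime (∣-trans r∣c c∣b)) (∣⇒≤ {{>-nonZero 0<e}} (∣-trans r∣c c∣e)))

squarefree⇒nonZero : ∀ {n} → Squarefree n → NonZero n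
squarefree⇒nonZero {zero}  sf with sf 2 (4 ∣0)
... | ()
squarefree⇒nonZero {suc n} _ = _

squarefree-∣ : ∀ {a n} → Squarefree n → a ∣ n → Squarefree a
squarefree-∣ sf a∣n k kk∣a = sf k (∣-trans kk∣a a∣n)

squarefree⇒∤cofactor : ∀ {m p} → Squarefree (m * p) → Prime p → ¬ p ∣ m
squarefree⇒∤cofactor {m} {p} sf p-prime p∣m =
  ¬prime[1] (subst Prime (sf p (*-monoˡ-∣ p p∣m)) p-prime)

prime[3] : Prime 3
prime[3] = from-yes (prime? 3)

2∣6 : 2 ∣ 6
2∣6 = divides 3 refl

3∣6 : 3 ∣ 6
3∣6 = divides 2 refl

2∣∧3∣⇒6∣ : ∀ {n} → 2 ∣ n → 3 ∣ n → 6 ∣ n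
2∣∧3∣⇒6∣ 2∣n (divides t n≡t3)
  with prime-∣-cofactor {m = t} prime[2] prime[3] (λ ()) (subst (2 ∣_) n≡t3 2∣n)
... | divides s t≡s2 = divides s (trans n≡t3 (trans (cong (_* 3) t≡s2) (*-assoc s 2 3)))

-- A squarefree multiple of 6 all of whose prime factors are at most 3 is at most 6:
-- a further factor s > 1 of n = 6 s would have a prime factor 2 or 3, whose square divides n.
squarefree-3-smooth⇒≤6 : ∀ {n} → Squarefree n → 6 ∣ n → (∀ r → Prime r → r ∣ n → r ≤ 3) → n ≤ 6
squarefree-3-smooth⇒≤6 {n} sf (divides s n≡s6) smooth with s ≤? 1
... | yes s≤1 = subst (_≤ 6) (sym n≡s6) (*-monoˡ-≤ 6 s≤1)
... | no  s≰1 with prime-factor (≰⇒> s≰1)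
...   | r , r-prime , r∣s =
  ⊥-elim (¬prime[1] (subst Prime (sf r (rr∣n r (smooth r r-prime r∣n) (prime≥2 r-prime) r∣s)) r-prime))
  where
    r∣n : r ∣ n
    r∣n = subst (r ∣_) (sym n≡s6) (∣m⇒∣m*n 6 r∣s)
    rr∣n : ∀ q → q ≤ 3 → 2 ≤ q → q ∣ s → q * q ∣ n
    rr∣n 1 _ (s≤s ()) _
    rr∣n 2 _ _ 2∣s = subst (4 ∣_) (sym n≡s6) (*-pres-∣ 2∣s (m∣m*n {2} 3))
    rr∣n 3 _ _ 3∣s = subst (9 ∣_) (sym n≡s6) (*-pres-∣ 3∣s (n∣m*n 2 {3}))
    rr∣n (suc (suc (suc (suc _)))) (s≤s (s≤s (s≤s ()))) _ _

WeaklyDense : ℕ → Set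
WeaklyDense m = ∀ e → e ∣ m → e < m → ∃[ e′ ] (e′ ∣ m × e < e′ × e′ ≤ 2 * e)

dense⇒weaklyDense : ∀ {m} → Dense m → WeaklyDense m
dense⇒weaklyDense D 0 0∣m _ =
  ⊥-elim (≢-nonZero⁻¹ _ {{squarefree⇒nonZero (Dense.squarefree D)}} (0∣⇒≡0 0∣m))
dense⇒weaklyDense D 1 _ _ = 2 , Dense.even D , s≤s (s≤s z≤n) , ≤-refl
dense⇒weaklyDense {m} D e@(suc (suc _)) e∣m e<m with 2 * e <? m
... | yes 2e<m with Dense.between D e e∣m (s≤s (s≤s z≤n)) 2e<m
...   | e′ , e′∣m , e<e′ , e′<2e = e′ , e′∣m , e<e′ , <⇒≤ e′<2e
dense⇒weaklyDense {m} D e@(suc (suc _)) e∣m e<m | no 2e≮m = m , ∣-refl , e<m , ≮⇒≥ 2e≮m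

c*2e≡2*ce : ∀ c e → c * (2 * e) ≡ 2 * (c * e)
c*2e≡2*ce c e = trans (sym (*-assoc c 2 e)) (trans (cong (_* e) (*-comm c 2)) (*-assoc 2 c e))

-- Walk up the divisors e of m with c e < y,
-- each step at most doubling, until c e first exceeds y.
scaled-divisor-between : ∀ {m} c y → WeaklyDense m → c < y → y < c * m →
  (∀ e → e ∣ m → c * e ≢ y) → ∃[ e ] (e ∣ m × y < c * e × c * e < 2 * y)
scaled-divisor-between {m} c y weak c<y y<cm c*e≢y =
  walk m 1 (n≤1+n m) (1∣ m) (subst (_< y) (sym (*-identityʳ c)) c<y)
  where
    -- fuel k bounds the number of steps: m ≤ e₀ + k
    walk : ∀ k e₀ → m ≤ e₀ + k → e₀ ∣ m → c * e₀ < y → ∃[ e ] (e ∣ m × y < c * e × c * e < 2 * y)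
    walk k e₀ m≤ e₀∣m ce₀<y with weak e₀ e₀∣m e₀<m
      where
        e₀<m : e₀ < m
        e₀<m = *-cancelˡ-< c e₀ m (<-trans ce₀<y y<cm)
    ... | e₁ , e₁∣m , e₀<e₁ , e₁≤2e₀ with c * e₁ <? y
    ...   | no ce₁≮y =
      e₁ , e₁∣m , ≤∧≢⇒< (≮⇒≥ ce₁≮y) (λ y≡ → c*e≢y e₁ e₁∣m (sym y≡)) ,
      ≤-<-trans (≤-trans (*-monoʳ-≤ c e₁≤2e₀) (≤-reflexive (c*2e≡2*ce c e₀))) (*-monoʳ-< 2 ce₀<y)
    walk zero e₀ m≤ e₀∣m ce₀<y | e₁ , _ , e₀<e₁ , _ | yes _ =
      ⊥-elim (<⇒≱ (*-cancelˡ-< c e₀ m (<-trans ce₀<y y<cm)) (subst (m ≤_) (+-identityʳ e₀) m≤))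
    walk (suc k) e₀ m≤ e₀∣m ce₀<y | e₁ , e₁∣m , e₀<e₁ , _ | yes ce₁<y =
      walk k e₁ (≤-trans m≤ (≤-trans (≤-reflexive (+-suc e₀ k)) (+-monoˡ-≤ k e₀<e₁))) e₁∣m ce₁<y

dense-multiple : ∀ {m p} → Dense m → Prime p → p < m → ¬ p ∣ m → Squarefree (m * p) → Dense (m * p)
dense-multiple {m} {p} D p-prime p<m p∤m sf =
  record { squarefree = sf ; even = ∣m⇒∣m*n p (Dense.even D) ; between = between }
  where
    instance
      m≢0 : NonZero m
      m≢0 = squarefree⇒nonZero (Dense.squarefree D)
      p≢0 : NonZero p
      p≢0 = prime⇒nonZero p-prime
    weak : WeaklyDense m
    weak = dense⇒weaklyDense D
    m<pm : m < p * m
    m<pm = subst (m <_) (*-comm m p) (m<m*n m p (prime≥2 p-prime))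
    p-scaled : ∀ {e} → e ∣ m → p * e ∣ m * p
    p-scaled {e} e∣m = subst (p * e ∣_) (*-comm p m) (*-monoʳ-∣ p e∣m)
    p*e∤m : ∀ {x} → x ∣ m → ∀ e → e ∣ m → p * e ≢ x
    p*e∤m x∣m e _ refl = p∤m (∣-trans (m∣m*n e) x∣m)
    -- x a divisor of m: x = m and x = m / 2 > p are covered by multiples p e, x = m / 2 < p by p,
    -- and the remaining x by the density of m
    between-divisor : ∀ x → x ∣ m → 2 ≤ x → DivisorBetween (m * p) x
    between-divisor x x∣m 2≤x with m≤n⇒m<n∨m≡n (∣⇒≤ x∣m)
    ... | inj₂ refl with scaled-divisor-between p m weak p<m m<pm (p*e∤m ∣-refl)
    ...   | e , e∣m , m<pe , pe<2m = p * e , p-scaled e∣m , m<pe , pe<2m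
    between-divisor x x∣m 2≤x | inj₁ x<m with m≤n⇒m<n∨m≡n (proper-divisor-≤-half x∣m x<m)
    ... | inj₁ 2x<m with Dense.between D x x∣m 2≤x 2x<m
    ...   | e , e∣m , x<e , e<2x = e , ∣m⇒∣m*n p e∣m , x<e , e<2x
    between-divisor x x∣m 2≤x | inj₁ x<m | inj₂ 2x≡m with <-cmp p x
    ... | tri< p<x _ _
      with scaled-divisor-between p x weak p<x (<-≤-trans x<m (<⇒≤ m<pm)) (p*e∤m x∣m)
    ...   | e , e∣m , x<pe , pe<2x = p * e , p-scaled e∣m , x<pe , pe<2x
    between-divisor x x∣m 2≤x | inj₁ x<m | inj₂ 2x≡m | tri≈ _ refl _ = ⊥-elim (p∤m x∣m)
    between-divisor x x∣m 2≤x | inj₁ x<m | inj₂ 2x≡m | tri> _ _ x<p =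
      p , n∣m*n m , x<p , subst (p <_) (sym 2x≡m) p<m
    -- x = p y with y a divisor of m: x = p is covered by a divisor of m, and for y ≥ 2 the
    -- divisor of m between y and 2y is scaled by p
    between-multiple : ∀ y → y ∣ m → 2 ≤ p * y → 2 * (p * y) < m * p → DivisorBetween (m * p) (p * y)
    between-multiple 0 _ 2≤p0 _ = ⊥-elim (<⇒≱ (subst (1 <_) (*-zeroʳ p) 2≤p0) z≤n)
    between-multiple 1 _ _ _
      with scaled-divisor-between 1 (p * 1) weak (subst (1 <_) (sym (*-identityʳ p)) (prime≥2 p-prime))
             (subst₂ _<_ (sym (*-identityʳ p)) (sym (*-identityˡ m)) p<m)
             (λ e e∣m 1e≡p1 → p∤m (subst (_∣ m) (trans (sym (*-identityˡ e)) (trans 1e≡p1 (*-identityʳ p))) e∣m))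
    ... | e , e∣m , p<1e , 1e<2p =
      1 * e , ∣m⇒∣m*n p (subst (_∣ m) (sym (*-identityˡ e)) e∣m) , p<1e , 1e<2p
    between-multiple y@(suc (suc _)) y∣m _ 2py<mp
      with Dense.between D y y∣m (s≤s (s≤s z≤n))
             (*-cancelˡ-< p (2 * y) m (subst₂ _<_ (sym (c*2e≡2*ce p y)) (*-comm m p) 2py<mp))
    ... | f , f∣m , y<f , f<2y =
      p * f , p-scaled f∣m , *-monoʳ-< p y<f , subst (p * f <_) (c*2e≡2*ce p y) (*-monoʳ-< p f<2y)
    between : ∀ x → x ∣ m * p → 2 ≤ x → 2 * x < m * p → DivisorBetween (m * p) x
    between x x∣mp 2≤x 2x<mp with divisor-of-multiple p-prime x∣mp
    ... | inj₁ x∣m = between-divisor x x∣m 2≤x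
    ... | inj₂ (y , refl , y∣m) = between-multiple y y∣m 2≤x 2x<mp

-- A gap factorisation n = A B: A is even and at least 4, B > 1, and all prime factors of
-- B exceed A. Divisors of n in (A/2, A) would then have to divide A, so n is not dense.
record Gap (n A B : ℕ) : Set where
  field
    factorisation : A * B ≡ n
    even : 2 ∣ A
    4≤A : 4 ≤ A
    1<B : 1 < B
    large : ∀ r → Prime r → r ∣ B → A < r

Gapless : ℕ → Set
Gapless n = ∀ A B → ¬ Gap n A B

dense⇒gapless : ∀ {n} → Dense n → Gapless n
dense⇒gapless {n} D A B gap = no-divisor (Dense.between D h h∣n 2≤h 2h<n)
  where
    open Gap gap
    h : ℕ
    h = quotient even
    A≡2h : A ≡ 2 * h
    A≡2h = m∣n⇒n≡m*quotient even
    h∣n : h ∣ n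
    h∣n = ∣-trans (quotient-∣ even) (subst (A ∣_) factorisation (m∣m*n B))
    2≤h : 2 ≤ h
    2≤h = *-cancelˡ-≤ 2 (subst (4 ≤_) A≡2h 4≤A)
    2h<n : 2 * h < n
    2h<n = subst₂ _<_ A≡2h factorisation (m<m*n A B {{>-nonZero (≤-trans (s≤s z≤n) 4≤A)}} 1<B)
    -- a divisor e of n in (A/2, A) lies below every prime factor of B, so it is coprime to B
    -- and divides A, which no e in (A/2, A) does
    no-divisor : DivisorBetween n h → ⊥
    no-divisor (e , e∣n , h<e , e<2h) =
      <⇒≱ (subst (_< 2 * e) (sym A≡2h) (*-monoʳ-< 2 h<e)) (proper-divisor-≤-half e∣A e<A)
      where
        e<A : e < A
        e<A = subst (e <_) (sym A≡2h) e<2h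
        e∣A : e ∣ A
        e∣A = coprime-divisor
          (coprime-to-large-primes (≤-<-trans z≤n h<e) (λ r r-prime r∣B → <-trans e<A (large r r-prime r∣B)))
          (subst (e ∣_) (trans (sym factorisation) (*-comm A B)) e∣n)

-- Removing the largest prime q from m q preserves gaplessness: a gap A B of m yields the
-- gap A (B q) of m q, as q is at least any prime factor of B, which exceeds A.
gapless-cofactor : ∀ {m q} → Gapless (m * q) → Prime q → (∀ r → Prime r → r ∣ m → r ≤ q) → Gapless m
gapless-cofactor {m} {q} gapless q-prime q-largest A B gap = gapless A (B * q) record
  { factorisation = trans (sym (*-assoc A B q)) (cong (_* q) factorisation)
  ; even = even ; 4≤A = 4≤A
  ; 1<B = <-≤-trans 1<B (m≤m*n B q {{prime⇒nonZero q-prime}})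
  ; large = large′ }
  where
    open Gap gap
    A<q : A < q
    A<q with prime-factor 1<B
    ... | s , s-prime , s∣B =
      <-≤-trans (large s s-prime s∣B) (q-largest s s-prime (∣-trans s∣B (subst (B ∣_) factorisation (n∣m*n A))))
    large′ : ∀ r → Prime r → r ∣ B * q → A < r
    large′ r r-prime r∣Bq with euclidsLemma B q r-prime r∣Bq
    ... | inj₁ r∣B = large r r-prime r∣B
    ... | inj₂ r∣q with prime⇒irreducible q-prime r∣q
    ...   | inj₁ refl = ⊥-elim (¬prime[1] r-prime)
    ...   | inj₂ refl = A<q

-- In a gapless m q with q prime not dividing the even number m ≥ 4, q < m:
-- otherwise m q itself is a gap factorisation.
gapless⇒prime<cofactor : ∀ {m q} → Gapless (m * q) → Prime q → ¬ q ∣ m → 2 ∣ m → 4 ≤ m → q < m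
gapless⇒prime<cofactor {m} {q} gapless q-prime q∤m 2∣m 4≤m with <-cmp q m
... | tri< q<m _ _ = q<m
... | tri≈ _ refl _ = ⊥-elim (q∤m ∣-refl)
... | tri> _ _ m<q = ⊥-elim (gapless m q record
  { factorisation = refl ; even = 2∣m ; 4≤A = 4≤m ; 1<B = prime≥2 q-prime ; large = large })
  where
    large : ∀ r → Prime r → r ∣ q → m < r
    large r r-prime r∣q with prime⇒irreducible q-prime r∣q
    ... | inj₁ refl = ⊥-elim (¬prime[1] r-prime)
    ... | inj₂ refl = m<q

record Admissible (n : ℕ) : Set where
  field
    squarefree : Squarefree n
    6∣n : 6 ∣ n
    gapless : Gapless n

peel : ∀ {n p m} → Admissible n → 6 < n → IsLargestPrimeFactor p n → m * p ≡ n → Admissible m × p < m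
peel {p = p} {m} adm 6<n (p-prime , _ , p-largest) refl =
  record { squarefree = squarefree-∣ squarefree (m∣m*n p) ; 6∣n = 6∣m ; gapless = gapless-m } ,
  gapless⇒prime<cofactor gapless p-prime (squarefree⇒∤cofactor squarefree p-prime) (∣-trans 2∣6 6∣m) 4≤m
  where
    open Admissible adm
    -- p > 3, since otherwise n ≤ 6
    3<p : 3 < p
    3<p with 3 <? p
    ... | yes 3<p = 3<p
    ... | no  3≮p = ⊥-elim (<⇒≱ 6<n (squarefree-3-smooth⇒≤6 squarefree 6∣n
                      (λ r r-prime r∣n → ≤-trans (p-largest r r-prime r∣n) (≮⇒≥ 3≮p))))
    6∣m : 6 ∣ m
    6∣m = 2∣∧3∣⇒6∣
      (prime-∣-cofactor prime[2] p-prime (<⇒≢ (<-trans (s≤s (s≤s (s≤s z≤n))) 3<p)) (∣-trans 2∣6 6∣n))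
      (prime-∣-cofactor prime[3] p-prime (<⇒≢ 3<p) (∣-trans 3∣6 6∣n))
    4≤m : 4 ≤ m
    4≤m = ≤-trans (s≤s (s≤s (s≤s (s≤s z≤n))))
                  (∣⇒≤ {{squarefree⇒nonZero (squarefree-∣ squarefree (m∣m*n p))}} 6∣m)
    gapless-m : Gapless m
    gapless-m = gapless-cofactor gapless p-prime (λ r r-prime r∣m → p-largest r r-prime (∣m⇒∣m*n p r∣m))

dense-6 : Squarefree 6 → Dense 6
dense-6 sf = record { squarefree = sf ; even = 2∣6 ; between = between }
  where
    between : ∀ x → x ∣ 6 → 2 ≤ x → 2 * x < 6 → DivisorBetween 6 x
    between 0 _ () _
    between 1 _ (s≤s ()) _
    between 2 _ _ _ = 3 , 3∣6 , ≤-refl , s≤s (s≤s (s≤s (s≤s z≤n)))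
    between (suc (suc (suc x))) _ _ 2x<6 = ⊥-elim (<⇒≱ 2x<6 (*-monoʳ-≤ 2 {3} (s≤s (s≤s (s≤s z≤n)))))

-- Every admissible number is strictly 2-dense, by strong induction: 6 is, and an
-- admissible m > 6 is P(m) times an admissible smaller number exceeding P(m).
admissible⇒dense : ∀ {m} → Admissible m → Dense m
admissible⇒dense {m} = <-rec (λ m → Admissible m → Dense m) step m
  where
    step : ∀ m → (∀ {m′} → m′ < m → Admissible m′ → Dense m′) → Admissible m → Dense m
    step m IH adm with m ≤? 6
    ... | yes m≤6 = subst Dense (sym m≡6) (dense-6 (subst Squarefree m≡6 squarefree))
      where
        open Admissible adm
        m≡6 : m ≡ 6
        m≡6 = ≤-antisym m≤6 (∣⇒≤ {{squarefree⇒nonZero squarefree}} 6∣n)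
    ... | no m≰6 with largest-prime-factor (<-trans (s≤s (s≤s z≤n)) (≰⇒> m≰6))
    ...   | q , q-largest@(q-prime , divides m′ m≡m′q , _) with peel adm (≰⇒> m≰6) q-largest (sym m≡m′q)
    ...     | adm′ , q<m′ = subst Dense (sym m≡m′q)
                (dense-multiple (IH m′<m adm′) q-prime q<m′ (squarefree⇒∤cofactor sf q-prime) sf)
      where
        sf : Squarefree (m′ * q)
        sf = subst Squarefree m≡m′q (Admissible.squarefree adm)
        m′<m : m′ < m
        m′<m = subst (m′ <_) (sym m≡m′q)
                 (m<m*n m′ q {{squarefree⇒nonZero (Admissible.squarefree adm′)}} (prime≥2 q-prime))

-- A strictly 2-dense n > 6 is admissible; in particular 3 ∣ n, as the divisor in (2, 4) is 3.
dense⇒admissible : ∀ {n} → Dense n → 6 < n → Admissible n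
dense⇒admissible {n} D 6<n =
  record { squarefree = squarefree ; 6∣n = 2∣∧3∣⇒6∣ even 3∣n ; gapless = dense⇒gapless D }
  where
    open Dense D
    3∣n : 3 ∣ n
    3∣n with between 2 even ≤-refl (≤-<-trans (s≤s (s≤s (s≤s (s≤s z≤n)))) 6<n)
    ... | e , e∣n , 2<e , e<4 = subst (_∣ n) (≤-antisym (≤-pred e<4) 2<e) e∣n

lemma5p8 : (n p m : ℕ) → 6 < n → Squarefree n → IsLargestPrimeFactor p n →
    m * p ≡ n → (Strictly2Dense n ⇔ (Strictly2Dense m × p * p < n))
lemma5p8 n p m 6<n sf p-largest@(p-prime , _ , _) m*p≡n = mk⇔ forward backward
  where
    sf-mp : Squarefree (m * p)
    sf-mp = subst Squarefree (sym m*p≡n) sf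
    instance
      n≢0 : NonZero n
      n≢0 = squarefree⇒nonZero sf
      m≢0 : NonZero m
      m≢0 = squarefree⇒nonZero (squarefree-∣ sf-mp (m∣m*n p))
    -- n dense ⇒ n admissible ⇒ m admissible with p < m ⇒ m dense and p² < m p = n
    forward : Strictly2Dense n → Strictly2Dense m × p * p < n
    forward S with peel (dense⇒admissible (to strictly2Dense⇔dense S) 6<n) 6<n p-largest m*p≡n
    ... | adm-m , p<m = from strictly2Dense⇔dense (admissible⇒dense adm-m) ,
                        subst (p * p <_) m*p≡n (*-monoˡ-< p {{prime⇒nonZero p-prime}} p<m)
    -- p² < n = m p gives p < m, and the multiple m p of the dense m is dense
    backward : Strictly2Dense m × p * p < n → Strictly2Dense n
    backward (S , p²<n) = from strictly2Dense⇔dense (subst Dense m*p≡n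
        (dense-multiple (to strictly2Dense⇔dense S) p-prime p<m (squarefree⇒∤cofactor sf-mp p-prime) sf-mp))
      where
        p<m : p < m
        p<m = *-cancelʳ-< p p m (subst (p * p <_) (sym m*p≡n) p²<n)
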